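{- Let $n\ge1$ and let $\Delta^n_{n-1}$ be the $(n-1)$-skeleton of the $n$-simplex $\Delta^n$. Then for every maximal simplex $\sigma$ of the barycentric subdivision $\operatorname{Bd}(\Delta^n_{n-1})$, the simplicial complex $\operatorname{Bd}(\Delta^n_{n-1})\setminus\{\sigma\}$ is collapsible.
   Context: A simplicial complex is a finite nonempty collection of finite sets closed under subsets (so it contains $\emptyset$); $\dim\sigma=|\sigma|-1$; $\alpha$ is a facet of $\beta$ if $\alpha\subseteq\beta$ and $\dim\alpha=\dim\beta-1$. $\Delta^n$ is the simplicial complex of all subsets of an $(n+1)$-element set, and $\Delta^n_{n-1}=\{\sigma\in\Delta^n:\dim\sigma\le n-1\}$. The barycentric subdivision $\operatorname{Bd}(\mathcal K)$ has a vertex $v_\tau$ for each nonempty $\tau\in\mathcal K$, and its simplices are the sets $\{v_{\tau_0},\dots,v_{\tau_m}\}$ with $\tau_0\subsetneq\dots\subsetneq\tau_m$ (together with $\emptyset$). A discrete vector field $\mathcal V$ on $\mathcal K$ is a set of pairs $(\alpha,\beta)$ of simplices ($\alpha=\emptyset$ allowed) with $\alpha$ a facet of $\beta$, each simplex in at most one pair. A $\mathcal V$-trajectory is a sequence $\beta_0,\alpha_1,\beta_1,\dots,\alpha_r,\beta_r$ of alternately $q$- and $(q-1)$-simplices with $(\alpha_i,\beta_i)\in\mathcal V$, $\alpha_i\subsetneq\beta_{i-1}$, $\beta_{i-1}\ne\beta_i$; nontrivial closed if $r>0$ and $\beta_r=\beta_0$. A gradient vector field has no nontrivial closed trajectory.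 A nonempty simplex is critical if it lies in no pair, or is a $0$-simplex $\sigma$ with $(\emptyset,\sigma)\in\mathcal V$. $\mathcal K$ is collapsible if it admits a gradient vector field whose only critical simplex is a single $0$-simplex, which is paired with $\emptyset$. -}

module Defs where

open import Data.Nat using (ℕ; zero; suc; _^_; _≤_)
open import Data.Fin using (Fin; remQuot)
import Data.Fin as Fin
import Data.Fin.Subset
open import Data.Fin.Subset using (Subset; _∈_; _⊆_; ∣_∣; Nonempty; ⊥; inside; outside)
open import Data.Vec using (_∷_; [])
open import Data.Product using (Σ; ∃; _×_; _,_; proj₁; proj₂)
open import Data.Sum using (_⊎_)
open import Relation.Binary.PropositionalEquality using (_≡_; _≢_)
open import Relation.Binary.Construct.Closure.Transitive using (TransClosure)
open import Relation.Nullary using (¬_)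

-- Finite simplicial complexes on the vertex set Fin m.
-- A simplex is a subset of Fin m (Data.Fin.Subset); a complex is given by
-- its membership predicate.  dim σ = ∣ σ ∣ - 1.

Complex : ℕ → Set₁
Complex m = Subset m → Set

IsComplex : ∀ {m} → Complex m → Set
IsComplex {m} K = K ⊥ × (∀ (σ τ : Subset m) → K τ → σ ⊆ τ → K σ)

Facet : ∀ {m} → Subset m → Subset m → Set
Facet α β = α ⊆ β × ∣ β ∣ ≡ suc ∣ α ∣

Maximal : ∀ {m} → Complex m → Subset m → Set
Maximal {m} K σ = K σ × (∀ (τ : Subset m) → K τ → σ ⊆ τ → τ ≡ σ)

_∖_ : ∀ {m} → Complex m → Subset m → Complex m
(K ∖ σ) τ = K τ × τ ≢ σ

-- The n-simplex on vertex set Fin (suc n) and its (n-1)-skeleton: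
-- all subsets of dimension ≤ n-1, i.e. of cardinality ≤ n.

Δ : (n : ℕ) → Complex (suc n)
Δ n σ = ∣ σ ∣ ≤ suc n   -- every subset of Fin (suc n)

Δskel : (n : ℕ) → Complex (suc n)
Δskel n σ = ∣ σ ∣ ≤ n

-- The vertex v_τ associated with τ ⊆ Fin m is
-- encoded as an element of Fin (2 ^ m) through the bijection
-- decode : Fin (2 ^ m) → Subset m  (binary digits via Data.Fin.remQuot).

bit : Fin 2 → Data.Fin.Subset.Side
bit Fin.zero = outside
bit (Fin.suc _) = inside

decode : (m : ℕ) → Fin (2 ^ m) → Subset m
decode zero _ = []
decode (suc k) i = bit (proj₁ (remQuot {2} (2 ^ k) i)) ∷ decode k (proj₂ (remQuot {2} (2 ^ k) i))

-- A set S of vertices of Bd(K) is a simplex iff its vertices are v_τ for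
-- nonempty τ ∈ K and they form a chain τ₀ ⊊ … ⊊ τ_r (pairwise comparable,
-- distinct vertices encode distinct τ).
Bd : ∀ {m} → Complex m → Complex (2 ^ m)
Bd {m} K S =
  (∀ i → i ∈ S → Nonempty (decode m i) × K (decode m i)) ×
  (∀ i j → i ∈ S → j ∈ S → decode m i ⊆ decode m j ⊎ decode m j ⊆ decode m i)

-- Discrete vector fields (Forman).  A set of pairs is given as a relation
-- V α β meaning (α , β) ∈ V.

record VectorField {m} (K : Complex m) (V : Subset m → Subset m → Set) : Set where
  field
    inK-α   : ∀ {α β} → V α β → K α
    inK-β   : ∀ {α β} → V α β → K β
    facet   : ∀ {α β} → V α β → Facet α β
    -- each simplex lies in at most one pair
    unique  : ∀ {α β α' β'} → V α β → V α' β' →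
              (α ≡ α' ⊎ α ≡ β' ⊎ β ≡ α' ⊎ β ≡ β') → α ≡ α' × β ≡ β'

-- one step β_{i-1}, α_i, β_i of a V-trajectory:
-- (α_i , β_i) ∈ V, α_i a facet of β_{i-1} (α_i ⊊ β_{i-1}, dims q-1 and q),
-- β_{i-1} ≢ β_i
TrajStep : ∀ {m} → (Subset m → Subset m → Set) → Subset m → Subset m → Set
TrajStep {m} V β β' = Σ (Subset m) λ α → V α β' × Facet α β × β ≢ β'

-- a nontrivial closed V-trajectory β₀, α₁, …, α_r, β_r = β₀ with r > 0
ClosedTrajectory : ∀ {m} → (Subset m → Subset m → Set) → Set
ClosedTrajectory {m} V = Σ (Subset m) λ β₀ → TransClosure (TrajStep V) β₀ β₀

Gradient : ∀ {m} → (Subset m → Subset m → Set) → Set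
Gradient V = ¬ ClosedTrajectory V

Vertex : ∀ {m} → Subset m → Set
Vertex σ = ∣ σ ∣ ≡ 1

Critical : ∀ {m} → Complex m → (Subset m → Subset m → Set) → Subset m → Set
Critical {m} K V σ = K σ × Nonempty σ ×
  ((¬ (Σ (Subset m) λ β → V σ β) × ¬ (Σ (Subset m) λ α → V α σ))
   ⊎ (Vertex σ × V ⊥ σ))

-- K is collapsible: it admits a gradient vector field whose only critical
-- simplex is a single 0-simplex, which is paired with ∅.
Collapsible : ∀ {m} → Complex m → Set₁
Collapsible {m} K =
  Σ (Subset m → Subset m → Set) λ V →
    VectorField K V × Gradient V ×
    (Σ (Subset m) λ v → K v × Vertex v × V ⊥ v ×
       (∀ σ → Critical K V σ → σ ≡ v))

{-# OPTIONS --safe #-}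
-- A maximal simplex σ of Bd(Δⁿₙ₋₁) is a complete flag of proper nonempty subsets of the vertex set
-- Fin (n + 1), so every vertex a has a least flag member hull σ a containing it (the whole vertex set
-- if there is none), and a ↦ hull σ a is injective. A chain C ≠ σ misses some proper flag member;
-- its pivot a is the vertex whose hull σ a is the smallest flag member missing from C. C is matched
-- with the chain obtained by toggling its mate hull C a - a, where hull C a is the least member of C
-- containing a (or everything). The mate is comparable with every member of C, is not a flag member
-- and does not contain a, so toggling it changes neither the pivot nor the mate: every chain is
-- matched, the empty one with a vertex. Along a trajectory the pivot's flag member can only shrink,
-- and while it stays the same the number of members containing the pivot strictly drops, so there
-- are no closed trajectories.

module Submission where

open import Defs
open import Data.Nat using (ℕ; zero; suc; _^_; _≤_; _<_; _<?_; _∸_; s≤s)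
open import Data.Nat.Properties
  using (≤-refl; ≤-pred; ≤-reflexive; <-≤-trans; ≮⇒≥; <⇒≱; ≤∧≢⇒<; ∸-cancelʳ-≤; <-isStrictPartialOrder)
open import Data.Fin using (Fin; zero; suc; combine; remQuot; _≟_)
open import Data.Fin.Properties using (any?; all?; remQuot-combine; combine-remQuot)
open import Data.Fin.Subset
  using (Subset; Side; _∈_; _∉_; _⊆_; ∣_∣; Nonempty; ⊥; ⊤; ⁅_⁆; _∪_; _─_; _-_; inside; outside)
open import Data.Fin.Subset.Properties
  using (_∈?_; _⊆?_; ⊆-refl; ⊆-antisym; ⊆-reflexive; ⊆⊤; ∈⊤; ∉⊥; ∣⊤∣≡n; ∣⊥∣≡0; ∣p∣≤n; ∣⁅x⁆∣≡1; ∪-identityʳ;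
         drop-not-there; p⊆q⇒∣p∣≤∣q∣; p⊂q⇒∣p∣<∣q∣; x∈p∪q⁻; x∈p∪q⁺; x∈⁅x⁆; x∈⁅y⁆⇒x≡y; p⊆p∪q; p─q⊆p;
         x∈p∧x≢y⇒x∈p-y)
open import Data.Vec using (_∷_; []; tabulate; here; there)
open import Data.Vec.Properties using (lookup∘tabulate; []=⇒lookup; lookup⇒[]=)
open import Data.Product using (∃; _×_; _,_; proj₁; proj₂; map₂)
open import Data.Product.Relation.Binary.Lex.Strict using (×-Lex; ×-isStrictPartialOrder)
open import Data.Product.Relation.Binary.Pointwise.NonDependent using (Pointwise)
open import Data.Sum using (_⊎_; inj₁; inj₂; swap; [_,_]′)
open import Function using (id; _∘_)
open import Relation.Binary using (Transitive; IsStrictPartialOrder)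
open import Relation.Binary.Construct.Closure.Transitive using (TransClosure; [_]; _∷_)
open import Relation.Binary.PropositionalEquality
  using (_≡_; _≢_; refl; sym; trans; cong; cong₂; subst; module ≡-Reasoning)
open import Relation.Nullary using (¬_; Dec; yes; no; does; contradiction)
open import Relation.Nullary.Decidable using (_×-dec_; _→-dec_; ¬?; decidable-stable)
open import Relation.Unary using (Decidable)

subsetOf : ∀ {m} {P : Fin m → Set} → Decidable P → Subset m
subsetOf P? = tabulate (λ j → does (P? j))

∈-subsetOf⁻ : ∀ {m} {P : Fin m → Set} (P? : Decidable P) {x} → x ∈ subsetOf P? → P x
∈-subsetOf⁻ P? {x} x∈ with P? x | trans (sym (lookup∘tabulate (λ j → does (P? j)) x)) ([]=⇒lookup x∈)
... | yes px | _ = px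

∈-subsetOf⁺ : ∀ {m} {P : Fin m → Set} (P? : Decidable P) {x} → P x → x ∈ subsetOf P?
∈-subsetOf⁺ P? {x} px = lookup⇒[]= x _ (trans (lookup∘tabulate (λ j → does (P? j)) x) (does-yes (P? x)))
  where
  does-yes : (d : Dec _) → does d ≡ inside
  does-yes (yes _) = refl
  does-yes (no ¬px) = contradiction px ¬px

p⊈q⇒∃∈p∉q : ∀ {m} {p q : Subset m} → ¬ p ⊆ q → ∃ λ x → x ∈ p × x ∉ q
p⊈q⇒∃∈p∉q {p = p} {q} p⊈q with any? (λ x → x ∈? p ×-dec ¬? (x ∈? q))
... | yes found = found
... | no ∄ = contradiction (λ {x} x∈p → decidable-stable (x ∈? q) (λ x∉q → ∄ (x , x∈p , x∉q))) p⊈q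

p⊆q∧∣q∣≤∣p∣⇒p≡q : ∀ {m} {p q : Subset m} → p ⊆ q → ∣ q ∣ ≤ ∣ p ∣ → p ≡ q
p⊆q∧∣q∣≤∣p∣⇒p≡q {p = p} {q} p⊆q ∣q∣≤∣p∣ = ⊆-antisym p⊆q (decidable-stable (q ⊆? p) q⊈p⇒⊥)
  where
  q⊈p⇒⊥ : ¬ ¬ q ⊆ p
  q⊈p⇒⊥ q⊈p with p⊈q⇒∃∈p∉q q⊈p
  ... | x , x∈q , x∉p = <⇒≱ (p⊂q⇒∣p∣<∣q∣ (p⊆q , x , x∈q , x∉p)) ∣q∣≤∣p∣

p⊆q∧p≢q⇒∣p∣<∣q∣ : ∀ {m} {p q : Subset m} → p ⊆ q → p ≢ q → ∣ p ∣ < ∣ q ∣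
p⊆q∧p≢q⇒∣p∣<∣q∣ p⊆q p≢q =
  ≤∧≢⇒< (p⊆q⇒∣p∣≤∣q∣ p⊆q) (λ ∣p∣≡∣q∣ → p≢q (p⊆q∧∣q∣≤∣p∣⇒p≡q p⊆q (≤-reflexive (sym ∣p∣≡∣q∣))))

x∉p⇒∣p∣≤n : ∀ {n} {p : Subset (suc n)} {x} → x ∉ p → ∣ p ∣ ≤ n
x∉p⇒∣p∣≤n {n} {p} {x} x∉p = ≤-pred (subst (∣ p ∣ <_) (∣⊤∣≡n (suc n)) (p⊂q⇒∣p∣<∣q∣ (⊆⊤ , x , ∈⊤ , x∉p)))

∣p∣≤n⇒∃∉p : ∀ {n} {p : Subset (suc n)} → ∣ p ∣ ≤ n → ∃ λ x → x ∉ p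
∣p∣≤n⇒∃∉p {n} {p} ∣p∣≤n = map₂ proj₂ (p⊈q⇒∃∈p∉q ⊤⊈p)
  where
  ⊤⊈p : ¬ ⊤ ⊆ p
  ⊤⊈p ⊤⊆p = <⇒≱ (s≤s ∣p∣≤n) (subst (_≤ ∣ p ∣) (∣⊤∣≡n (suc n)) (p⊆q⇒∣p∣≤∣q∣ ⊤⊆p))

Comparable : ∀ {m} → Subset m → Subset m → Set
Comparable p q = p ⊆ q ⊎ q ⊆ p

comparable∧∣p∣≤∣q∣⇒p⊆q : ∀ {m} {p q : Subset m} → Comparable p q → ∣ p ∣ ≤ ∣ q ∣ → p ⊆ q
comparable∧∣p∣≤∣q∣⇒p⊆q (inj₁ p⊆q) _ = p⊆q
comparable∧∣p∣≤∣q∣⇒p⊆q (inj₂ q⊆p) ∣p∣≤∣q∣ = ⊆-reflexive (sym (p⊆q∧∣q∣≤∣p∣⇒p≡q q⊆p ∣p∣≤∣q∣))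

∣p∪⁅x⁆∣≡1+∣p∣ : ∀ {m} (p : Subset m) {x} → x ∉ p → ∣ p ∪ ⁅ x ⁆ ∣ ≡ suc ∣ p ∣
∣p∪⁅x⁆∣≡1+∣p∣ (inside ∷ p) {zero} x∉p = contradiction here x∉p
∣p∪⁅x⁆∣≡1+∣p∣ (outside ∷ p) {zero} x∉p = cong (λ q → suc ∣ q ∣) (∪-identityʳ p)
∣p∪⁅x⁆∣≡1+∣p∣ (inside ∷ p) {suc x} x∉p = cong suc (∣p∪⁅x⁆∣≡1+∣p∣ p (drop-not-there x∉p))
∣p∪⁅x⁆∣≡1+∣p∣ (outside ∷ p) {suc x} x∉p = ∣p∪⁅x⁆∣≡1+∣p∣ p (drop-not-there x∉p)

x∈p∪⁅y⁆⇒x∈p⊎x≡y : ∀ {m} {p : Subset m} {x y} → x ∈ p ∪ ⁅ y ⁆ → x ∈ p ⊎ x ≡ y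
x∈p∪⁅y⁆⇒x∈p⊎x≡y {p = p} {y = y} x∈ with x∈p∪q⁻ p ⁅ y ⁆ x∈
... | inj₁ x∈p = inj₁ x∈p
... | inj₂ x∈⁅y⁆ = inj₂ (x∈⁅y⁆⇒x≡y y x∈⁅y⁆)

x∈p∪⁅x⁆ : ∀ {m} (p : Subset m) x → x ∈ p ∪ ⁅ x ⁆
x∈p∪⁅x⁆ p x = x∈p∪q⁺ (inj₂ (x∈⁅x⁆ x))

x∈p─q⇒x∉q : ∀ {m} {p q : Subset m} {x} → x ∈ p ─ q → x ∉ q
x∈p─q⇒x∉q {p = _ ∷ _} {outside ∷ _} here ()
x∈p─q⇒x∉q {p = _ ∷ _} {_ ∷ _} (there x∈p─q) (there x∈q) = x∈p─q⇒x∉q x∈p─q x∈q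

x∈p-y⇒x≢y : ∀ {m} {p : Subset m} {x y} → x ∈ p - y → x ≢ y
x∈p-y⇒x≢y {x = x} x∈ refl = x∈p─q⇒x∉q x∈ (x∈⁅x⁆ x)

x∉p⇒p∪⁅x⁆-x≡p : ∀ {m} {p : Subset m} {x} → x ∉ p → (p ∪ ⁅ x ⁆) - x ≡ p
x∉p⇒p∪⁅x⁆-x≡p {p = p} {x} x∉p = ⊆-antisym ⊆p ⊇p
  where
  ⊆p : (p ∪ ⁅ x ⁆) - x ⊆ p
  ⊆p {e} e∈ with x∈p∪⁅y⁆⇒x∈p⊎x≡y (p─q⊆p _ _ e∈)
  ... | inj₁ e∈p = e∈p
  ... | inj₂ e≡x = contradiction e≡x (x∈p-y⇒x≢y e∈)
  ⊇p : p ⊆ (p ∪ ⁅ x ⁆) - x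
  ⊇p e∈p = x∈p∧x≢y⇒x∈p-y (p⊆p∪q _ e∈p) (λ { refl → x∉p e∈p })

x∈p⇒p-x∪⁅x⁆≡p : ∀ {m} {p : Subset m} {x} → x ∈ p → (p - x) ∪ ⁅ x ⁆ ≡ p
x∈p⇒p-x∪⁅x⁆≡p {p = p} {x} x∈p = ⊆-antisym ⊆p ⊇p
  where
  ⊆p : (p - x) ∪ ⁅ x ⁆ ⊆ p
  ⊆p e∈ with x∈p∪⁅y⁆⇒x∈p⊎x≡y e∈
  ... | inj₁ e∈p-x = p─q⊆p _ _ e∈p-x
  ... | inj₂ refl = x∈p
  ⊇p : p ⊆ (p - x) ∪ ⁅ x ⁆
  ⊇p {e} e∈p with e ≟ x
  ... | yes refl = x∈p∪⁅x⁆ _ x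
  ... | no e≢x = p⊆p∪q _ (x∈p∧x≢y⇒x∈p-y e∈p e≢x)

p⊆q∧∣q∣≡1+∣p∣⇒p∪⁅x⁆≡q : ∀ {m} {p q : Subset m} {x} → p ⊆ q → ∣ q ∣ ≡ suc ∣ p ∣ → x ∈ q → x ∉ p → p ∪ ⁅ x ⁆ ≡ q
p⊆q∧∣q∣≡1+∣p∣⇒p∪⁅x⁆≡q {p = p} {q} {x} p⊆q ∣q∣≡ x∈q x∉p =
  p⊆q∧∣q∣≤∣p∣⇒p≡q p∪⁅x⁆⊆q (≤-reflexive (trans ∣q∣≡ (sym (∣p∪⁅x⁆∣≡1+∣p∣ p x∉p))))
  where
  p∪⁅x⁆⊆q : p ∪ ⁅ x ⁆ ⊆ q
  p∪⁅x⁆⊆q e∈ with x∈p∪⁅y⁆⇒x∈p⊎x≡y e∈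
  ... | inj₁ e∈p = p⊆q e∈p
  ... | inj₂ refl = x∈q

_≈[_]_ : ∀ {m} → Subset m → Fin m → Subset m → Set
p ≈[ x ] q = ∀ {y} → y ≢ x → (y ∈ p → y ∈ q) × (y ∈ q → y ∈ p)

p≈[x]p∪⁅x⁆ : ∀ {m} {p : Subset m} {x} → p ≈[ x ] (p ∪ ⁅ x ⁆)
p≈[x]p∪⁅x⁆ y≢x = p⊆p∪q _ , λ y∈ → [ id , (λ y≡x → contradiction y≡x y≢x) ]′ (x∈p∪⁅y⁆⇒x∈p⊎x≡y y∈)

p≈[x]p-x : ∀ {m} {p : Subset m} {x} → p ≈[ x ] (p - x)
p≈[x]p-x y≢x = (λ y∈p → x∈p∧x≢y⇒x∈p-y y∈p y≢x) , p─q⊆p _ _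

∃-minimal : ∀ {m} {P : Fin m → Set} → Decidable P → (f : Fin m → ℕ) → ∃ P →
            ∃ λ j → P j × (∀ k → P k → f j ≤ f k)
∃-minimal {m} {P} P? f (i , pi) = descend (suc (f i)) i ≤-refl pi
  where
  descend : ∀ bound i → f i < bound → P i → ∃ λ j → P j × (∀ k → P k → f j ≤ f k)
  descend (suc bound) i fi<bound pi with any? (λ k → P? k ×-dec (f k <? f i))
  ... | yes (k , pk , fk<fi) = descend bound k (<-≤-trans fk<fi (≤-pred fi<bound)) pk
  ... | no ∄smaller = i , pi , λ k pk → ≮⇒≥ (λ fk<fi → ∄smaller (k , pk , fk<fi))

bit⁻¹ : Side → Fin 2
bit⁻¹ outside = zero
bit⁻¹ inside = suc zero

bit∘bit⁻¹ : ∀ s → bit (bit⁻¹ s) ≡ s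
bit∘bit⁻¹ outside = refl
bit∘bit⁻¹ inside = refl

bit⁻¹∘bit : ∀ b → bit⁻¹ (bit b) ≡ b
bit⁻¹∘bit zero = refl
bit⁻¹∘bit (suc zero) = refl

encode : (m : ℕ) → Subset m → Fin (2 ^ m)
encode zero [] = zero
encode (suc m) (s ∷ p) = combine (bit⁻¹ s) (encode m p)

decode-combine : ∀ m b q → decode (suc m) (combine b q) ≡ bit b ∷ decode m q
decode-combine m b q = cong (λ r → bit (proj₁ r) ∷ decode m (proj₂ r)) (remQuot-combine {2} {2 ^ m} b q)

decode∘encode : ∀ m p → decode m (encode m p) ≡ p
decode∘encode zero [] = refl
decode∘encode (suc m) (s ∷ p) =
  trans (decode-combine m (bit⁻¹ s) (encode m p)) (cong₂ _∷_ (bit∘bit⁻¹ s) (decode∘encode m p))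

encode∘decode : ∀ m i → encode m (decode m i) ≡ i
encode∘decode zero zero = refl
encode∘decode (suc m) i = begin
  combine (bit⁻¹ (bit b)) (encode m (decode m q)) ≡⟨ cong₂ combine (bit⁻¹∘bit b) (encode∘decode m q) ⟩
  combine b q                                       ≡⟨ combine-remQuot {2} (2 ^ m) i ⟩
  i                                                 ∎
  where
  open ≡-Reasoning
  b : Fin 2
  b = proj₁ (remQuot {2} (2 ^ m) i)
  q : Fin (2 ^ m)
  q = proj₂ (remQuot {2} (2 ^ m) i)

encode-injective : ∀ m {p q} → encode m p ≡ encode m q → p ≡ q
encode-injective m {p} {q} eq = begin
  p                     ≡⟨ sym (decode∘encode m p) ⟩
  decode m (encode m p) ≡⟨ cong (decode m) eq ⟩
  decode m (encode m q) ≡⟨ decode∘encode m q ⟩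
  q                     ∎
  where open ≡-Reasoning

decode≡⇒≡encode : ∀ m {i p} → decode m i ≡ p → i ≡ encode m p
decode≡⇒≡encode m {i} eq = trans (sym (encode∘decode m i)) (cong (encode m) eq)

maximal-∪⁅⁆⇒∈ : ∀ {m} {K : Complex m} {σ x} → Maximal K σ → K (σ ∪ ⁅ x ⁆) → x ∈ σ
maximal-∪⁅⁆⇒∈ {σ = σ} {x} (_ , maximal) Kσ∪⁅x⁆ =
  subst (x ∈_) (maximal _ Kσ∪⁅x⁆ (p⊆p∪q _)) (x∈p∪⁅x⁆ σ x)

module _ {m : ℕ} where

  private
    ⟦_⟧ : Fin (2 ^ m) → Subset m
    ⟦_⟧ = decode m

    ⌞_⌟ : Subset m → Fin (2 ^ m)
    ⌞_⌟ = encode m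

  module _ (L : Complex m) where

    Bd-⊥ : Bd L ⊥
    Bd-⊥ = (λ _ i∈⊥ → contradiction i∈⊥ ∉⊥) , (λ _ _ i∈⊥ _ → contradiction i∈⊥ ∉⊥)

    Bd-⊆ : ∀ {C C′} → C′ ⊆ C → Bd L C → Bd L C′
    Bd-⊆ C′⊆C (vertices , chain) =
      (λ i i∈ → vertices i (C′⊆C i∈)) , (λ i j i∈ j∈ → chain i j (C′⊆C i∈) (C′⊆C j∈))

    Bd-∪⁅⁆ : ∀ {C x} → Bd L C → Nonempty ⟦ x ⟧ → L ⟦ x ⟧ →
             (∀ {e} → e ∈ C → Comparable ⟦ x ⟧ ⟦ e ⟧) → Bd L (C ∪ ⁅ x ⁆)
    Bd-∪⁅⁆ {C} {x} (vertices , chain) x≠∅ Lx x~C = vertices′ , chain′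
      where
      vertices′ : ∀ i → i ∈ C ∪ ⁅ x ⁆ → Nonempty ⟦ i ⟧ × L ⟦ i ⟧
      vertices′ i i∈ with x∈p∪⁅y⁆⇒x∈p⊎x≡y i∈
      ... | inj₁ i∈C = vertices i i∈C
      ... | inj₂ refl = x≠∅ , Lx
      chain′ : ∀ i j → i ∈ C ∪ ⁅ x ⁆ → j ∈ C ∪ ⁅ x ⁆ → Comparable ⟦ i ⟧ ⟦ j ⟧
      chain′ i j i∈ j∈ with x∈p∪⁅y⁆⇒x∈p⊎x≡y i∈ | x∈p∪⁅y⁆⇒x∈p⊎x≡y j∈
      ... | inj₁ i∈C | inj₁ j∈C = chain i j i∈C j∈C
      ... | inj₁ i∈C | inj₂ refl = swap (x~C i∈C)
      ... | inj₂ refl | inj₁ j∈C = x~C j∈C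
      ... | inj₂ refl | inj₂ refl = inj₁ ⊆-refl

    Bd-∪⁅⌞_⌟⁆ : ∀ {C} X → Bd L C → Nonempty X → L X →
                (∀ {e} → e ∈ C → Comparable X ⟦ e ⟧) → Bd L (C ∪ ⁅ ⌞ X ⌟ ⁆)
    Bd-∪⁅⌞_⌟⁆ {C} X = subst (λ Y → Bd L C → Nonempty Y → L Y → (∀ {e} → e ∈ C → Comparable Y ⟦ e ⟧) →
                                  Bd L (C ∪ ⁅ ⌞ X ⌟ ⁆))
                           (decode∘encode m X) Bd-∪⁅⁆

  IsChain : Subset (2 ^ m) → Set
  IsChain C = ∀ e f → e ∈ C → f ∈ C → Comparable ⟦ e ⟧ ⟦ f ⟧

  InHull : Subset (2 ^ m) → Fin m → Fin m → Set
  InHull C a j = ∀ e → e ∈ C → a ∈ ⟦ e ⟧ → j ∈ ⟦ e ⟧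

  -- Opaque so that membership goals never unfold hull (and decode with it), which makes
  -- type checking prohibitively slow.
  opaque
    InHull? : ∀ C a → Decidable (InHull C a)
    InHull? C a j = all? (λ e → e ∈? C →-dec (a ∈? ⟦ e ⟧ →-dec j ∈? ⟦ e ⟧))

    hull : Subset (2 ^ m) → Fin m → Subset m
    hull C a = subsetOf (InHull? C a)

    ∈hull⁺ : ∀ {C a j} → InHull C a j → j ∈ hull C a
    ∈hull⁺ {C} {a} = ∈-subsetOf⁺ (InHull? C a)

    hull-⊆ : ∀ {C a e} → e ∈ C → a ∈ ⟦ e ⟧ → hull C a ⊆ ⟦ e ⟧
    hull-⊆ {C} {a} e∈C a∈e j∈hull = ∈-subsetOf⁻ (InHull? C a) j∈hull _ e∈C a∈e

  a∈hull : ∀ {C} a → a ∈ hull C a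
  a∈hull a = ∈hull⁺ λ _ _ a∈e → a∈e

  ∈hull⇒hull⊆ : ∀ {C a j} → j ∈ hull C a → hull C j ⊆ hull C a
  ∈hull⇒hull⊆ j∈hull k∈hull = ∈hull⁺ λ e e∈C a∈e → hull-⊆ e∈C (hull-⊆ e∈C a∈e j∈hull) k∈hull

  hull-antitone : ∀ {C C′ a} → (∀ {e} → e ∈ C → a ∈ ⟦ e ⟧ → e ∈ C′) → hull C′ a ⊆ hull C a
  hull-antitone C⊆C′ j∈hull = ∈hull⁺ λ e e∈C a∈e → hull-⊆ (C⊆C′ e∈C a∈e) a∈e j∈hull

  hull-transfer : ∀ {C C′ a x} → (∀ {e} → a ∈ ⟦ e ⟧ → e ≢ x) → C ≈[ x ] C′ → hull C a ≡ hull C′ a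
  hull-transfer ∋a⇒≢x C≈C′ = ⊆-antisym
    (hull-antitone λ e∈C′ a∈e → proj₂ (C≈C′ (∋a⇒≢x a∈e)) e∈C′)
    (hull-antitone λ e∈C a∈e → proj₁ (C≈C′ (∋a⇒≢x a∈e)) e∈C)

  mate : Subset (2 ^ m) → Fin m → Subset m
  mate C a = hull C a - a

  a∉mate : ∀ C a → a ∉ mate C a
  a∉mate C a a∈mate = x∈p-y⇒x≢y a∈mate refl

  module _ {C : Subset (2 ^ m)} (C-chain : IsChain C) where

    ∉⇒⊆hull : ∀ {a e} → e ∈ C → a ∉ ⟦ e ⟧ → ⟦ e ⟧ ⊆ hull C a
    ∉⇒⊆hull {a} {e} e∈C a∉e {j} j∈e = ∈hull⁺ j∈every
      where
      j∈every : InHull C a j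
      j∈every f f∈C a∈f with C-chain e f e∈C f∈C
      ... | inj₁ e⊆f = e⊆f j∈e
      ... | inj₂ f⊆e = contradiction (f⊆e a∈f) a∉e

    hull-comparable-∈ : ∀ {a e} → e ∈ C → Comparable (hull C a) ⟦ e ⟧
    hull-comparable-∈ {a} {e} e∈C with a ∈? ⟦ e ⟧
    ... | yes a∈e = inj₁ (hull-⊆ e∈C a∈e)
    ... | no a∉e = inj₂ (∉⇒⊆hull e∈C a∉e)

    hull-comparable : ∀ a b → Comparable (hull C a) (hull C b)
    hull-comparable a b with b ∈? hull C a
    ... | yes b∈hull-a = inj₂ (∈hull⇒hull⊆ b∈hull-a)
    ... | no b∉hull-a = inj₁ (∈hull⇒hull⊆ (∈hull⁺ a∈every))
      where
      a∈every : InHull C b a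
      a∈every f f∈C b∈f = decidable-stable (a ∈? ⟦ f ⟧) (λ a∉f → b∉hull-a (∉⇒⊆hull f∈C a∉f b∈f))

    hull-attained : ∀ {a e} → e ∈ C → a ∈ ⟦ e ⟧ → ∃ λ h → h ∈ C × ⟦ h ⟧ ≡ hull C a
    hull-attained {a} {e} e∈C a∈e
      with ∃-minimal (λ h → h ∈? C ×-dec a ∈? ⟦ h ⟧) (λ h → ∣ ⟦ h ⟧ ∣) (e , e∈C , a∈e)
    ... | h , (h∈C , a∈h) , minimal =
      h , h∈C , ⊆-antisym (λ j∈h → ∈hull⁺ λ f f∈C a∈f → h⊆ f∈C a∈f j∈h) (hull-⊆ h∈C a∈h)
      where
      h⊆ : ∀ {f} → f ∈ C → a ∈ ⟦ f ⟧ → ⟦ h ⟧ ⊆ ⟦ f ⟧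
      h⊆ {f} f∈C a∈f = comparable∧∣p∣≤∣q∣⇒p⊆q (C-chain h f h∈C f∈C) (minimal f (f∈C , a∈f))

    mate-comparable : ∀ {a e} → e ∈ C → Comparable (mate C a) ⟦ e ⟧
    mate-comparable {a} {e} e∈C with a ∈? ⟦ e ⟧
    ... | yes a∈e = inj₁ λ j∈mate → hull-⊆ e∈C a∈e (p─q⊆p _ _ j∈mate)
    ... | no a∉e = inj₂ λ j∈e → x∈p∧x≢y⇒x∈p-y (∉⇒⊆hull e∈C a∉e j∈e) λ { refl → a∉e j∈e }

  ∋a⇒≢⌞mate⌟ : ∀ {C a e} → a ∈ ⟦ e ⟧ → e ≢ ⌞ mate C a ⌟
  ∋a⇒≢⌞mate⌟ {C} {a} a∈e refl = a∉mate C a (subst (a ∈_) (decode∘encode m (mate C a)) a∈e)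

  opaque
    containing : Subset (2 ^ m) → Fin m → Subset (2 ^ m)
    containing C a = subsetOf (λ e → e ∈? C ×-dec a ∈? ⟦ e ⟧)

    ∈containing⁺ : ∀ {C a e} → e ∈ C → a ∈ ⟦ e ⟧ → e ∈ containing C a
    ∈containing⁺ {C} {a} e∈C a∈e = ∈-subsetOf⁺ (λ e → e ∈? C ×-dec a ∈? ⟦ e ⟧) (e∈C , a∈e)

    ∈containing⁻ : ∀ {C a e} → e ∈ containing C a → e ∈ C × a ∈ ⟦ e ⟧
    ∈containing⁻ {C} {a} = ∈-subsetOf⁻ (λ e → e ∈? C ×-dec a ∈? ⟦ e ⟧)

  ∈∪⁅⌞mate⌟⁆⇒∈ : ∀ {C C′ a e} → e ∈ C ∪ ⁅ ⌞ mate C′ a ⌟ ⁆ → a ∈ ⟦ e ⟧ → e ∈ C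
  ∈∪⁅⌞mate⌟⁆⇒∈ e∈ a∈e with x∈p∪⁅y⁆⇒x∈p⊎x≡y e∈
  ... | inj₁ e∈C = e∈C
  ... | inj₂ e≡x = contradiction e≡x (∋a⇒≢⌞mate⌟ a∈e)

  containing-descends : ∀ {γ α a} →
    α ⊆ γ ∪ ⁅ ⌞ mate γ a ⌟ ⁆ → ∣ γ ∪ ⁅ ⌞ mate γ a ⌟ ⁆ ∣ ≡ suc ∣ α ∣ → ⌞ mate α a ⌟ ∉ α →
    γ ∪ ⁅ ⌞ mate γ a ⌟ ⁆ ≢ α ∪ ⁅ ⌞ mate α a ⌟ ⁆ →
    ∣ containing (α ∪ ⁅ ⌞ mate α a ⌟ ⁆) a ∣ < ∣ containing (γ ∪ ⁅ ⌞ mate γ a ⌟ ⁆) a ∣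
  containing-descends {γ} {α} {a} α⊆β ∣β∣≡1+∣α∣ x′∉α β≢β′ = p⊆q∧p≢q⇒∣p∣<∣q∣ shrinks differs
    where
    shrinks : containing (α ∪ ⁅ ⌞ mate α a ⌟ ⁆) a ⊆ containing (γ ∪ ⁅ ⌞ mate γ a ⌟ ⁆) a
    shrinks e∈ with ∈containing⁻ e∈
    ... | e∈β′ , a∈e = ∈containing⁺ (α⊆β (∈∪⁅⌞mate⌟⁆⇒∈ e∈β′ a∈e)) a∈e
    differs : containing (α ∪ ⁅ ⌞ mate α a ⌟ ⁆) a ≢ containing (γ ∪ ⁅ ⌞ mate γ a ⌟ ⁆) a
    differs same = β≢β′ (begin
      γ ∪ ⁅ ⌞ mate γ a ⌟ ⁆ ≡⟨ sym (p⊆q∧∣q∣≡1+∣p∣⇒p∪⁅x⁆≡q α⊆β ∣β∣≡1+∣α∣ (x∈p∪⁅x⁆ γ _) x∉α) ⟩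
      α ∪ ⁅ ⌞ mate γ a ⌟ ⁆ ≡⟨ cong (λ x → α ∪ ⁅ x ⁆) x≡x′ ⟩
      α ∪ ⁅ ⌞ mate α a ⌟ ⁆ ∎)
      where
      open ≡-Reasoning
      β∋a⇒α∋ : ∀ {e} → e ∈ γ ∪ ⁅ ⌞ mate γ a ⌟ ⁆ → a ∈ ⟦ e ⟧ → e ∈ α
      β∋a⇒α∋ {e} e∈β a∈e =
        ∈∪⁅⌞mate⌟⁆⇒∈ (proj₁ (∈containing⁻ (subst (e ∈_) (sym same) (∈containing⁺ e∈β a∈e)))) a∈e
      x≡x′ : ⌞ mate γ a ⌟ ≡ ⌞ mate α a ⌟
      x≡x′ = cong (λ X → ⌞ X - a ⌟) (begin
        hull γ a                        ≡⟨ hull-transfer ∋a⇒≢⌞mate⌟ p≈[x]p∪⁅x⁆ ⟩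
        hull (γ ∪ ⁅ ⌞ mate γ a ⌟ ⁆) a  ≡⟨ ⊆-antisym (hull-antitone (λ e∈α _ → α⊆β e∈α)) (hull-antitone β∋a⇒α∋) ⟩
        hull α a                        ∎)
      x∉α : ⌞ mate γ a ⌟ ∉ α
      x∉α = subst (_∉ α) (sym x≡x′) x′∉α

descending-rank⇒gradient : ∀ {m} {V : Subset m → Subset m → Set} {A : Set} {_≺_ : A → A → Set} →
  Transitive _≺_ → (∀ {r} → ¬ r ≺ r) →
  (rank : ∀ {α β} → V α β → A) →
  (∀ {γ β β′} (v : V γ β) (step : TrajStep V β β′) → rank (proj₁ (proj₂ step)) ≺ rank v) →
  Gradient V
descending-rank⇒gradient {V = V} {_≺_ = _≺_} ≺-trans ≺-irrefl rank descends (β₀ , cycle) =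
  ≺-irrefl (descends⁺ (proj₂ (lastPair cycle)) cycle)
  where
  lastPair : ∀ {β β′} → TransClosure (TrajStep V) β β′ → ∃ λ α → V α β′
  lastPair [ α , v , _ ] = α , v
  lastPair (_ ∷ steps) = lastPair steps
  descends⁺ : ∀ {γ β β′} (v : V γ β) (steps : TransClosure (TrajStep V) β β′) →
              rank (proj₂ (lastPair steps)) ≺ rank v
  descends⁺ v [ step ] = descends v step
  descends⁺ v (step ∷ steps) = ≺-trans (descends⁺ (proj₁ (proj₂ step)) steps) (descends v step)

module Toggling {m} (K : Complex m) (Toggle : Subset m → Fin m → Set)
  (toggle : ∀ {C} → K C → ∃ (Toggle C))
  (toggle-unique : ∀ {C x y} → Toggle C x → Toggle C y → x ≡ y)
  (toggle-insert : ∀ {C x} → K C → Toggle C x → x ∉ C → K (C ∪ ⁅ x ⁆) × Toggle (C ∪ ⁅ x ⁆) x)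
  (toggle-remove : ∀ {C x} → K C → Toggle C x → x ∈ C → K (C - x) × Toggle (C - x) x)
  where

  Pairing : Subset m → Subset m → Set
  Pairing α β = K α × ∃ λ x → Toggle α x × x ∉ α × β ≡ α ∪ ⁅ x ⁆

  upper : ∀ {α β} → Pairing α β → K β × ∃ λ x → Toggle β x × x ∈ β × α ≡ β - x
  upper {α} (Kα , x , tα , x∉α , refl) with toggle-insert Kα tα x∉α
  ... | Kβ , tβ = Kβ , x , tβ , x∈p∪⁅x⁆ α x , sym (x∉p⇒p∪⁅x⁆-x≡p x∉α)

  lower-unique : ∀ {α β β′} → Pairing α β → Pairing α β′ → β ≡ β′
  lower-unique {α} (_ , x , t , _ , refl) (_ , x′ , t′ , _ , refl) = cong (λ y → α ∪ ⁅ y ⁆) (toggle-unique t t′)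

  upper-unique : ∀ {α α′ β} → Pairing α β → Pairing α′ β → α ≡ α′
  upper-unique {β = β} p p′ with upper p | upper p′
  ... | _ , x , t , _ , refl | _ , x′ , t′ , _ , refl = cong (β -_) (toggle-unique t t′)

  ¬lower∧upper : ∀ {α β γ} → Pairing α β → ¬ Pairing γ α
  ¬lower∧upper (_ , x , t , x∉α , _) p with upper p
  ... | _ , x′ , t′ , x′∈α , _ = x∉α (subst (_∈ _) (toggle-unique t′ t) x′∈α)

  vectorField : VectorField K Pairing
  vectorField = record
    { inK-α = proj₁
    ; inK-β = λ p → proj₁ (upper p)
    ; facet = λ { {α} (_ , x , _ , x∉α , refl) → p⊆p∪q _ , ∣p∪⁅x⁆∣≡1+∣p∣ α x∉α }
    ; unique = unique
    }
    where
    unique : ∀ {α β α′ β′} → Pairing α β → Pairing α′ β′ →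
             (α ≡ α′ ⊎ α ≡ β′ ⊎ β ≡ α′ ⊎ β ≡ β′) → α ≡ α′ × β ≡ β′
    unique p p′ (inj₁ refl) = refl , lower-unique p p′
    unique p p′ (inj₂ (inj₁ refl)) = contradiction p′ (¬lower∧upper p)
    unique p p′ (inj₂ (inj₂ (inj₁ refl))) = contradiction p (¬lower∧upper p′)
    unique p p′ (inj₂ (inj₂ (inj₂ refl))) = upper-unique p p′ , refl

  paired : ∀ {C} → K C → (∃ λ β → Pairing C β) ⊎ (∃ λ α → Pairing α C)
  paired {C} KC with toggle KC
  ... | x , t with x ∈? C
  ... | no x∉C = inj₁ (_ , KC , x , t , x∉C , refl)
  ... | yes x∈C with toggle-remove KC t x∈C
  ...   | KC-x , tC-x = inj₂ (C - x , KC-x , x , tC-x , (λ x∈C-x → x∈p-y⇒x≢y x∈C-x refl) , sym (x∈p⇒p-x∪⁅x⁆≡p x∈C))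

  collapsible : K ⊥ → Gradient Pairing → Collapsible K
  collapsible K⊥ gradient with toggle K⊥
  ... | x , t = Pairing , vectorField , gradient , ⊥ ∪ ⁅ x ⁆ , proj₁ (upper v) , vertex , v , onlyCritical
    where
    v : Pairing ⊥ (⊥ ∪ ⁅ x ⁆)
    v = K⊥ , x , t , ∉⊥ , refl
    vertex : Vertex (⊥ ∪ ⁅ x ⁆)
    vertex = trans (∣p∪⁅x⁆∣≡1+∣p∣ (⊥ {n = m}) {x} ∉⊥) (cong suc (∣⊥∣≡0 m))
    onlyCritical : ∀ τ → Critical K Pairing τ → τ ≡ ⊥ ∪ ⁅ x ⁆
    onlyCritical τ (Kτ , _ , inj₁ (unpaired-up , unpaired-down)) with paired Kτ
    ... | inj₁ up = contradiction up unpaired-up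
    ... | inj₂ down = contradiction down unpaired-down
    onlyCritical τ (_ , _ , inj₂ (_ , u)) = lower-unique u v

_<ₗₑₓ_ : ℕ × ℕ → ℕ × ℕ → Set
_<ₗₑₓ_ = ×-Lex _≡_ _<_ _<_

<ₗₑₓ-isStrictPartialOrder : IsStrictPartialOrder (Pointwise _≡_ _≡_) _<ₗₑₓ_
<ₗₑₓ-isStrictPartialOrder = ×-isStrictPartialOrder <-isStrictPartialOrder <-isStrictPartialOrder

<ₗₑₓ-trans : Transitive _<ₗₑₓ_
<ₗₑₓ-trans = IsStrictPartialOrder.trans <ₗₑₓ-isStrictPartialOrder

<ₗₑₓ-irrefl : ∀ {r} → ¬ r <ₗₑₓ r
<ₗₑₓ-irrefl = IsStrictPartialOrder.irrefl <ₗₑₓ-isStrictPartialOrder (refl , refl)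

module FlagMatching {n : ℕ} {σ : Subset (2 ^ suc n)} (σ-maximal : Maximal (Bd (Δskel n)) σ) where

  ⟦_⟧ : Fin (2 ^ suc n) → Subset (suc n)
  ⟦_⟧ = decode (suc n)

  ⌞_⌟ : Subset (suc n) → Fin (2 ^ suc n)
  ⌞_⌟ = encode (suc n)

  ⟦⌞_⌟⟧ : ∀ X → ⟦ ⌞ X ⌟ ⟧ ≡ X
  ⟦⌞_⌟⟧ = decode∘encode (suc n)

  K : Complex (2 ^ suc n)
  K = Bd (Δskel n) ∖ σ

  σ-vertex : ∀ {e} → e ∈ σ → Nonempty ⟦ e ⟧ × ∣ ⟦ e ⟧ ∣ ≤ n
  σ-vertex = proj₁ (proj₁ σ-maximal) _

  σ-chain : IsChain σ
  σ-chain = proj₂ (proj₁ σ-maximal)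

  comparable⇒∈σ : ∀ X → Nonempty X → ∣ X ∣ ≤ n → (∀ {e} → e ∈ σ → Comparable X ⟦ e ⟧) → ⌞ X ⌟ ∈ σ
  comparable⇒∈σ X X≠∅ ∣X∣≤n X~σ =
    maximal-∪⁅⁆⇒∈ σ-maximal (Bd-∪⁅⌞_⌟⁆ (Δskel n) X (proj₁ σ-maximal) X≠∅ ∣X∣≤n X~σ)

  K⊥ : 1 ≤ n → K ⊥
  K⊥ 1≤n = Bd-⊥ (Δskel n) , ⊥≢σ
    where
    ⊥≢σ : ⊥ ≢ σ
    ⊥≢σ refl = ∉⊥ (comparable⇒∈σ ⁅ zero ⁆ (zero , x∈⁅x⁆ zero) (subst (_≤ n) (sym (∣⁅x⁆∣≡1 (zero {n}))) 1≤n)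
                                  (λ e∈⊥ → contradiction e∈⊥ ∉⊥))

  proper-hull∈σ : ∀ {a z} → z ∉ hull σ a → ⌞ hull σ a ⌟ ∈ σ
  proper-hull∈σ {a} z∉hull = comparable⇒∈σ (hull σ a) (a , a∈hull a) (x∉p⇒∣p∣≤n z∉hull) (hull-comparable-∈ σ-chain)

  -- If i ≠ j had the same hull, then hull σ i - j would be comparable with all of σ, hence a
  -- member of σ by maximality, although it contains i but not all of hull σ i.
  hull-injective : ∀ {i j} → hull σ i ≡ hull σ j → i ≡ j
  hull-injective {i} {j} hull-i≡hull-j with i ≟ j
  ... | yes i≡j = i≡j
  ... | no i≢j =
    contradiction refl (x∈p-y⇒x≢y (hull-i⊆Y (subst (j ∈_) (sym hull-i≡hull-j) (a∈hull j))))
    where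
    Y : Subset (suc n)
    Y = hull σ i - j
    Y~σ : ∀ {e} → e ∈ σ → Comparable Y ⟦ e ⟧
    Y~σ {e} e∈σ with i ∈? ⟦ e ⟧ | j ∈? ⟦ e ⟧
    ... | yes i∈e | _ = inj₁ λ k∈Y → hull-⊆ e∈σ i∈e (p─q⊆p _ _ k∈Y)
    ... | no _ | yes j∈e = inj₁ λ {k} k∈Y → hull-⊆ e∈σ j∈e (subst (k ∈_) hull-i≡hull-j (p─q⊆p _ _ k∈Y))
    ... | no i∉e | no j∉e = inj₂ λ k∈e → x∈p∧x≢y⇒x∈p-y (∉⇒⊆hull σ-chain e∈σ i∉e k∈e) λ { refl → j∉e k∈e }
    i∈Y : i ∈ Y
    i∈Y = x∈p∧x≢y⇒x∈p-y (a∈hull i) i≢j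
    Y∈σ : ⌞ Y ⌟ ∈ σ
    Y∈σ = comparable⇒∈σ Y (i , i∈Y) (x∉p⇒∣p∣≤n {p = Y} (λ j∈Y → x∈p-y⇒x≢y j∈Y refl)) Y~σ
    hull-i⊆Y : hull σ i ⊆ Y
    hull-i⊆Y = subst (hull σ i ⊆_) ⟦⌞ Y ⌟⟧ (hull-⊆ Y∈σ (subst (i ∈_) (sym ⟦⌞ Y ⌟⟧) i∈Y))

  ∈σ⇒≡hull : ∀ {e} → e ∈ σ → ∃ λ b → ⟦ e ⟧ ≡ hull σ b
  ∈σ⇒≡hull {e} e∈σ
    with ∃-minimal (_∈? ⟦ e ⟧) (λ b → suc n ∸ ∣ hull σ b ∣) (proj₁ (σ-vertex e∈σ))
  ... | b , b∈e , b-largest = b , ⊆-antisym e⊆hull-b (hull-⊆ e∈σ b∈e)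
    where
    e⊆hull-b : ⟦ e ⟧ ⊆ hull σ b
    e⊆hull-b {c} c∈e = comparable∧∣p∣≤∣q∣⇒p⊆q (hull-comparable σ-chain c b)
                         (∸-cancelʳ-≤ (∣p∣≤n (hull σ c)) (b-largest c c∈e)) (a∈hull c)

  missing-proper-hull : ∀ {C} → K C → ∃ λ b → ⌞ hull σ b ⌟ ∉ C × ∃ λ z → z ∉ hull σ b
  missing-proper-hull {C} (bdC , C≢σ)
    with any? (λ b → ¬? (⌞ hull σ b ⌟ ∈? C) ×-dec any? (λ z → ¬? (z ∈? hull σ b)))
  ... | yes found = found
  ... | no ∄ = contradiction (proj₂ σ-maximal C bdC σ⊆C) C≢σ
    where
    σ⊆C : σ ⊆ C
    σ⊆C {e} e∈σ = decidable-stable (e ∈? C) λ e∉C → ∄ (missing e∉C (∈σ⇒≡hull e∈σ))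
      where
      missing : e ∉ C → (∃ λ b → ⟦ e ⟧ ≡ hull σ b) → ∃ λ b → ⌞ hull σ b ⌟ ∉ C × ∃ λ z → z ∉ hull σ b
      missing e∉C (b , ⟦e⟧≡hull-b) =
        b , subst (_∉ C) (decode≡⇒≡encode (suc n) ⟦e⟧≡hull-b) e∉C ,
        ∣p∣≤n⇒∃∉p (subst (λ X → ∣ X ∣ ≤ n) ⟦e⟧≡hull-b (proj₂ (σ-vertex e∈σ)))

  Pivot : Subset (2 ^ suc n) → Fin (suc n) → Set
  Pivot C a = ⌞ hull σ a ⌟ ∉ C × (∀ b → ⌞ hull σ b ⌟ ∉ C → hull σ a ⊆ hull σ b)

  pivot : ∀ {C} → K C → ∃ (Pivot C)
  pivot {C} KC with missing-proper-hull KC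
  ... | b , hull-b∉C , _
    with ∃-minimal (λ b → ¬? (⌞ hull σ b ⌟ ∈? C)) (λ b → ∣ hull σ b ∣) (b , hull-b∉C)
  ... | a , hull-a∉C , a-least =
    a , hull-a∉C , λ b hull-b∉C → comparable∧∣p∣≤∣q∣⇒p⊆q (hull-comparable σ-chain a b) (a-least b hull-b∉C)

  pivot-unique : ∀ {C a b} → Pivot C a → Pivot C b → a ≡ b
  pivot-unique (hull-a∉C , a-least) (hull-b∉C , b-least) =
    hull-injective (⊆-antisym (a-least _ hull-b∉C) (b-least _ hull-a∉C))

  pivot-proper : ∀ {C a} → K C → Pivot C a → ∃ λ z → z ∉ hull σ a
  pivot-proper KC (_ , a-least) with missing-proper-hull KC
  ... | b , hull-b∉C , z , z∉hull-b = z , λ z∈hull-a → z∉hull-b (a-least b hull-b∉C z∈hull-a)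

  pivot∈σ : ∀ {C a} → K C → Pivot C a → ⌞ hull σ a ⌟ ∈ σ
  pivot∈σ KC piv = proper-hull∈σ (proj₂ (pivot-proper KC piv))

  pivot-transfer : ∀ {C C′ a x} → (∀ b → ⌞ hull σ b ⌟ ≢ x) → C ≈[ x ] C′ → Pivot C a → Pivot C′ a
  pivot-transfer hull≢x C≈C′ (hull-a∉C , a-least) =
    (λ hull-a∈C′ → hull-a∉C (proj₂ (C≈C′ (hull≢x _)) hull-a∈C′)) ,
    (λ b hull-b∉C′ → a-least b (λ hull-b∈C → hull-b∉C′ (proj₁ (C≈C′ (hull≢x b)) hull-b∈C)))

  hullσ⊆hull : ∀ {C a} → K C → Pivot C a → hull σ a ⊆ hull C a
  hullσ⊆hull {C} {a} (bdC , _) (_ , a-least) {z} z∈hull-a with z ≟ a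
  ... | yes refl = a∈hull a
  ... | no z≢a = ∉⇒⊆hull (proj₂ bdC) hull-z∈C (subst (a ∉_) (sym ⟦⌞ hull σ z ⌟⟧) a∉hull-z)
                               (subst (z ∈_) (sym ⟦⌞ hull σ z ⌟⟧) (a∈hull z))
    where
    a∉hull-z : a ∉ hull σ z
    a∉hull-z a∈hull-z = z≢a (hull-injective (⊆-antisym (∈hull⇒hull⊆ z∈hull-a) (∈hull⇒hull⊆ a∈hull-z)))
    hull-z∈C : ⌞ hull σ z ⌟ ∈ C
    hull-z∈C = decidable-stable (⌞ hull σ z ⌟ ∈? C) (λ hull-z∉C → a∉hull-z (a-least z hull-z∉C (a∈hull a)))

  hull⊈hullσ : ∀ {C a} → K C → Pivot C a → ¬ hull C a ⊆ hull σ a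
  hull⊈hullσ {C} {a} KC piv hull⊆hull-a with any? (λ e → e ∈? C ×-dec a ∈? ⟦ e ⟧)
  ... | yes (e , e∈C , a∈e) with hull-attained (proj₂ (proj₁ KC)) e∈C a∈e
  ...   | h , h∈C , ⟦h⟧≡hull-C-a =
    proj₁ piv (subst (_∈ C) (decode≡⇒≡encode (suc n) ⟦h⟧≡hull-a) h∈C)
    where
    ⟦h⟧≡hull-a : ⟦ h ⟧ ≡ hull σ a
    ⟦h⟧≡hull-a = trans ⟦h⟧≡hull-C-a (⊆-antisym hull⊆hull-a (hullσ⊆hull KC piv))
  hull⊈hullσ KC piv hull⊆hull-a | no ∄ with pivot-proper KC piv
  ... | z , z∉hull-a = z∉hull-a (hull⊆hull-a (∈hull⁺ λ e e∈C a∈e → contradiction (e , e∈C , a∈e) ∄))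

  mate-escapes : ∀ {C a} → K C → Pivot C a → ∃ λ y → y ∈ mate C a × y ∉ hull σ a
  mate-escapes {C} {a} KC piv with p⊈q⇒∃∈p∉q (hull⊈hullσ KC piv)
  ... | y , y∈hull , y∉hull-a = y , x∈p∧x≢y⇒x∈p-y y∈hull (λ { refl → y∉hull-a (a∈hull a) }) , y∉hull-a

  mate≢hull : ∀ {C a} → K C → Pivot C a → ∀ b → mate C a ≢ hull σ b
  mate≢hull {C} {a} KC piv b mate≡hull-b with mate-escapes KC piv | hull-comparable σ-chain a b
  ... | _ | inj₁ hull-a⊆hull-b = a∉mate C a (subst (a ∈_) (sym mate≡hull-b) (hull-a⊆hull-b (a∈hull a)))
  ... | y , y∈mate , y∉hull-a | inj₂ hull-b⊆hull-a = y∉hull-a (hull-b⊆hull-a (subst (y ∈_) mate≡hull-b y∈mate))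

  ⌞hull⌟≢⌞mate⌟ : ∀ {C a} → K C → Pivot C a → ∀ b → ⌞ hull σ b ⌟ ≢ ⌞ mate C a ⌟
  ⌞hull⌟≢⌞mate⌟ KC piv b eq = mate≢hull KC piv b (sym (encode-injective (suc n) eq))

  Bd-∪⁅⌞mate⌟⁆ : ∀ {C a} → K C → Pivot C a → Bd (Δskel n) (C ∪ ⁅ ⌞ mate C a ⌟ ⁆)
  Bd-∪⁅⌞mate⌟⁆ {C} {a} KC piv with mate-escapes KC piv
  ... | y , y∈mate , _ = Bd-∪⁅⌞_⌟⁆ (Δskel n) (mate C a) (proj₁ KC) (y , y∈mate) (x∉p⇒∣p∣≤n (a∉mate C a))
                                   (mate-comparable (proj₂ (proj₁ KC)))

  Toggle : Subset (2 ^ suc n) → Fin (2 ^ suc n) → Set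
  Toggle C x = ∃ λ a → Pivot C a × x ≡ ⌞ mate C a ⌟

  toggle : ∀ {C} → K C → ∃ (Toggle C)
  toggle KC with pivot KC
  ... | a , piv = _ , a , piv , refl

  toggle-unique : ∀ {C x y} → Toggle C x → Toggle C y → x ≡ y
  toggle-unique (a , piv , refl) (b , piv′ , refl) with pivot-unique piv piv′
  ... | refl = refl

  toggle-transfer : ∀ {C C′ a} → K C → Pivot C a → Bd (Δskel n) C′ → C ≈[ ⌞ mate C a ⌟ ] C′ →
                    K C′ × Toggle C′ ⌞ mate C a ⌟
  toggle-transfer {C} {C′} {a} KC piv bdC′ C≈C′ =
    (bdC′ , C′≢σ) , a , piv′ , cong (λ X → ⌞ X - a ⌟) (hull-transfer ∋a⇒≢⌞mate⌟ C≈C′)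
    where
    piv′ : Pivot C′ a
    piv′ = pivot-transfer (⌞hull⌟≢⌞mate⌟ KC piv) C≈C′ piv
    C′≢σ : C′ ≢ σ
    C′≢σ refl = proj₁ piv′ (pivot∈σ KC piv)

  toggle-insert : ∀ {C x} → K C → Toggle C x → x ∉ C → K (C ∪ ⁅ x ⁆) × Toggle (C ∪ ⁅ x ⁆) x
  toggle-insert KC (_ , piv , refl) _ = toggle-transfer KC piv (Bd-∪⁅⌞mate⌟⁆ KC piv) p≈[x]p∪⁅x⁆

  toggle-remove : ∀ {C x} → K C → Toggle C x → x ∈ C → K (C - x) × Toggle (C - x) x
  toggle-remove KC (_ , piv , refl) _ = toggle-transfer KC piv (Bd-⊆ (Δskel n) (p─q⊆p _ _) (proj₁ KC)) p≈[x]p-x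

  open Toggling K Toggle toggle toggle-unique toggle-insert toggle-remove public

  rank : ∀ {α β} → Pairing α β → ℕ × ℕ
  rank {β = β} (_ , _ , (a , _) , _) = ∣ hull σ a ∣ , ∣ containing β a ∣

  rank-descends : ∀ {γ β β′} (p : Pairing γ β) (step : TrajStep Pairing β β′) →
                  rank (proj₁ (proj₂ step)) <ₗₑₓ rank p
  rank-descends (Kγ , _ , (a , piv , refl) , _ , refl)
                (α , (_ , _ , (a′ , piv′ , refl) , x′∉α , refl) , (α⊆β , ∣β∣≡1+∣α∣) , β≢β′)
    with a′ ≟ a
  ... | yes refl = inj₂ (refl , containing-descends α⊆β ∣β∣≡1+∣α∣ x′∉α β≢β′)
  ... | no a′≢a = inj₁ (p⊆q∧p≢q⇒∣p∣<∣q∣ (proj₂ piv′ a hull-a∉α) (a′≢a ∘ hull-injective))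
    where
    hull-a∉α : ⌞ hull σ a ⌟ ∉ α
    hull-a∉α hull-a∈α = proj₁ (pivot-transfer (⌞hull⌟≢⌞mate⌟ Kγ piv) p≈[x]p∪⁅x⁆ piv) (α⊆β hull-a∈α)

lemma4p3 : (n : ℕ) → 1 ≤ n → (σ : Subset (2 ^ suc n)) → Maximal (Bd (Δskel n)) σ → Collapsible (Bd (Δskel n) ∖ σ)
lemma4p3 n 1≤n σ σ-maximal =
  collapsible (K⊥ 1≤n) (descending-rank⇒gradient {_≺_ = _<ₗₑₓ_} <ₗₑₓ-trans <ₗₑₓ-irrefl rank rank-descends)
  where
  open FlagMatching σ-maximal
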